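{- Let $X$ be a di-co-expression whose vertices are items with positive integer sizes, and let $c$ be a positive integer capacity. For $0\le s\le c$: (1) For a single vertex $a_j$, $F(a_j,s)=1$ if and only if $s=0$ or $s=s_j$. (2) $F(X_1\oplus X_2,s)=1$ if and only if there are $0\le s'\le s$ and $0\le s''\le s$ with $s'+s''=s$, $F(X_1,s')=1$ and $F(X_2,s'')=1$. (3) $F(X_1\oslash X_2,s)=1$ if and only if either $0\le s\le s(X_2)$ and $F(X_2,s)=1$, or there is an $s'>0$ with $s=s'+s(X_2)$ and $F(X_1,s')=1$. (4) $F(X_1\otimes X_2,s)=1$ if and only if $s=0$ or $s=s(X_1)+s(X_2)$. In all other cases the respective value is $0$.
   Context: Directed co-graph operations on vertex-disjoint digraphs $G_1=(V_1,E_1)$, $G_2=(V_2,E_2)$: disjoint union $G_1\oplus G_2$ (vertex set $V_1\cup V_2$, arc set $E_1\cup E_2$); series composition $G_1\otimes G_2$ (disjoint union plus arcs $(u,v)$ and $(v,u)$ for all $u\in V_1$, $v\in V_2$); order composition $G_1\oslash G_2$ (disjoint union plus arcs $(u,v)$ for all $u\in V_1$, $v\in V_2$). A di-co-expression is a term built from single vertices by these operations; for a di-co-expression $X'$, $g(X')$ is the digraph it defines and $s(X')$ is the sum of the sizes of all vertices of $g(X')$. For a di-co-expression $X'$ and integer $s$, $F(X',s)=1$ if there exists a subset $A'$ of the vertices of $g(X')$ with $\sum_{a_j\in A'}s_j=s$, $\sum_{a_j\in A'}s_j\le c$, and such that for every vertex $y$ of $g(X')$, if some predecessor of $y$ in $g(X')$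 lies in $A'$ then $y\in A'$; otherwise $F(X',s)=0$. -}

module Defs where

open import Data.Nat using (ℕ; zero; suc; _+_; _≤_; _<_)
open import Data.Bool using (Bool; true; false; if_then_else_)
open import Data.Unit using (⊤; tt)
open import Data.Empty using (⊥)
open import Data.Sum using (_⊎_; inj₁; inj₂)
open import Data.Product using (Σ; _×_)
open import Relation.Binary.PropositionalEquality using (_≡_)

data DiCo : Set where
  item  : (size : ℕ) → DiCo
  _⊕_   : DiCo → DiCo → DiCo
  _⊗_   : DiCo → DiCo → DiCo
  _⊘_   : DiCo → DiCo → DiCo

Vertex : DiCo → Set
Vertex (item _)  = ⊤
Vertex (X ⊕ Y)   = Vertex X ⊎ Vertex Y
Vertex (X ⊗ Y)   = Vertex X ⊎ Vertex Y
Vertex (X ⊘ Y)   = Vertex X ⊎ Vertex Y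

Arc : (X : DiCo) → Vertex X → Vertex X → Set
Arc (item _) _ _                 = ⊥
Arc (X ⊕ Y) (inj₁ u) (inj₁ v)    = Arc X u v
Arc (X ⊕ Y) (inj₂ u) (inj₂ v)    = Arc Y u v
Arc (X ⊕ Y) _ _                  = ⊥
Arc (X ⊗ Y) (inj₁ u) (inj₁ v)    = Arc X u v
Arc (X ⊗ Y) (inj₂ u) (inj₂ v)    = Arc Y u v
Arc (X ⊗ Y) _ _                  = ⊤
Arc (X ⊘ Y) (inj₁ u) (inj₁ v)    = Arc X u v
Arc (X ⊘ Y) (inj₂ u) (inj₂ v)    = Arc Y u v
Arc (X ⊘ Y) (inj₁ u) (inj₂ v)    = ⊤
Arc (X ⊘ Y) (inj₂ u) (inj₁ v)    = ⊥

AllPos : DiCo → Set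
AllPos (item a) = 0 < a
AllPos (X ⊕ Y)  = AllPos X × AllPos Y
AllPos (X ⊗ Y)  = AllPos X × AllPos Y
AllPos (X ⊘ Y)  = AllPos X × AllPos Y

sumSel : (X : DiCo) → (Vertex X → Bool) → ℕ
sumSel (item a) A = if A tt then a else 0
sumSel (X ⊕ Y) A  = sumSel X (λ v → A (inj₁ v)) + sumSel Y (λ v → A (inj₂ v))
sumSel (X ⊗ Y) A  = sumSel X (λ v → A (inj₁ v)) + sumSel Y (λ v → A (inj₂ v))
sumSel (X ⊘ Y) A  = sumSel X (λ v → A (inj₁ v)) + sumSel Y (λ v → A (inj₂ v))

totalSize : DiCo → ℕ
totalSize X = sumSel X (λ _ → true)

-- F(X, s) = 1 (with capacity c): some successor-closed vertex subset A
-- has total size exactly s and at most c.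
F : (c : ℕ) → DiCo → ℕ → Set
F c X s = Σ (Vertex X → Bool) λ A →
  (sumSel X A ≡ s) × (sumSel X A ≤ c) ×
  (∀ x y → Arc X x y → A x ≡ true → A y ≡ true)

module Submission where

-- Each of the four clauses is proved as an equivalence by
-- splitting a closed selection of the composed expression into its two
-- restrictions (which are closed in the operands) and, conversely, by
-- copairing closed selections of the operands.

open import Defs
open import Data.Nat using (ℕ; zero; suc; _+_; _≤_; _<_; z≤n; s≤s; _≟_)
open import Data.Nat.Properties
  using (≤-refl; ≤-trans; +-mono-≤; m≤m+n; m≤n+m; n≢0⇒n>0)
open import Data.Bool using (Bool; true; false)
open import Data.Unit using (tt)
open import Data.Product using (Σ; _×_; ∃; _,_)
open import Data.Sum using (_⊎_; inj₁; inj₂; [_,_])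
open import Function.Bundles using (_⇔_; mk⇔)
open import Relation.Binary.PropositionalEquality
  using (_≡_; refl; sym; trans; cong; cong₂; subst)
open import Relation.Nullary using (yes; no)

Closed : (X : DiCo) → (Vertex X → Bool) → Set
Closed X A = ∀ x y → Arc X x y → A x ≡ true → A y ≡ true

witness : ∀ {c s} X (A : Vertex X → Bool) →
          sumSel X A ≡ s → s ≤ c → Closed X A → F c X s
witness X A refl s≤c closed = A , refl , s≤c , closed

sumSel-cong : ∀ X {A B : Vertex X → Bool} → (∀ x → A x ≡ B x) →
              sumSel X A ≡ sumSel X B
sumSel-cong (item a) A≗B rewrite A≗B tt = refl
sumSel-cong (X ⊕ Y) A≗B =
  cong₂ _+_ (sumSel-cong X (λ x → A≗B (inj₁ x))) (sumSel-cong Y (λ y → A≗B (inj₂ y)))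
sumSel-cong (X ⊗ Y) A≗B =
  cong₂ _+_ (sumSel-cong X (λ x → A≗B (inj₁ x))) (sumSel-cong Y (λ y → A≗B (inj₂ y)))
sumSel-cong (X ⊘ Y) A≗B =
  cong₂ _+_ (sumSel-cong X (λ x → A≗B (inj₁ x))) (sumSel-cong Y (λ y → A≗B (inj₂ y)))

sumSel-none : ∀ X → sumSel X (λ _ → false) ≡ 0
sumSel-none (item a) = refl
sumSel-none (X ⊕ Y)  = cong₂ _+_ (sumSel-none X) (sumSel-none Y)
sumSel-none (X ⊗ Y)  = cong₂ _+_ (sumSel-none X) (sumSel-none Y)
sumSel-none (X ⊘ Y)  = cong₂ _+_ (sumSel-none X) (sumSel-none Y)

sumSel-all : ∀ X (A : Vertex X → Bool) → (∀ x → A x ≡ true) →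
             sumSel X A ≡ totalSize X
sumSel-all X A all = sumSel-cong X all

sumSel≤totalSize : ∀ X (A : Vertex X → Bool) → sumSel X A ≤ totalSize X
sumSel≤totalSize (item a) A with A tt
... | true  = ≤-refl
... | false = z≤n
sumSel≤totalSize (X ⊕ Y) A = +-mono-≤ (sumSel≤totalSize X _) (sumSel≤totalSize Y _)
sumSel≤totalSize (X ⊗ Y) A = +-mono-≤ (sumSel≤totalSize X _) (sumSel≤totalSize Y _)
sumSel≤totalSize (X ⊘ Y) A = +-mono-≤ (sumSel≤totalSize X _) (sumSel≤totalSize Y _)

+-positive : ∀ m {n} → 0 < m + n → 0 < m ⊎ 0 < n
+-positive zero    0<n = inj₂ 0<n
+-positive (suc m) _   = inj₁ (s≤s z≤n)

selected-of-positive : ∀ X (A : Vertex X → Bool) → 0 < sumSel X A →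
                       ∃ λ x → A x ≡ true
selected-in-pair : ∀ X Y (A : Vertex X ⊎ Vertex Y → Bool) →
  0 < sumSel X (λ x → A (inj₁ x)) + sumSel Y (λ y → A (inj₂ y)) →
  ∃ λ v → A v ≡ true

selected-of-positive (item a) A 0<sum with A tt in Att
... | true = tt , Att
selected-of-positive (X ⊕ Y) A 0<sum = selected-in-pair X Y A 0<sum
selected-of-positive (X ⊗ Y) A 0<sum = selected-in-pair X Y A 0<sum
selected-of-positive (X ⊘ Y) A 0<sum = selected-in-pair X Y A 0<sum

selected-in-pair X Y A 0<sum with +-positive (sumSel X _) 0<sum
... | inj₁ 0<left with x , Ax ← selected-of-positive X _ 0<left = inj₁ x , Ax
... | inj₂ 0<right with y , Ay ← selected-of-positive Y _ 0<right = inj₂ y , Ay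

none-closed : ∀ X → Closed X (λ _ → false)
none-closed X _ _ _ ()

all-closed : ∀ X → Closed X (λ _ → true)
all-closed X _ _ _ _ = refl

someVertex : ∀ X → Vertex X
someVertex (item _) = tt
someVertex (X ⊕ Y)  = inj₁ (someVertex X)
someVertex (X ⊗ Y)  = inj₁ (someVertex X)
someVertex (X ⊘ Y)  = inj₁ (someVertex X)

-- In X₁ ⊗ X₂ every vertex is a successor of a successor of every vertex,
-- so a closed selection with one member selects everything.
series-saturated : ∀ X₁ X₂ (A : Vertex (X₁ ⊗ X₂) → Bool) → Closed (X₁ ⊗ X₂) A →
                   ∀ x → A x ≡ true → ∀ y → A y ≡ true
series-saturated X₁ X₂ A closed (inj₁ x) Ax (inj₂ y) = closed (inj₁ x) (inj₂ y) tt Ax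
series-saturated X₁ X₂ A closed (inj₂ x) Ax (inj₁ y) = closed (inj₂ x) (inj₁ y) tt Ax
series-saturated X₁ X₂ A closed (inj₁ x) Ax (inj₁ y) =
  closed (inj₂ (someVertex X₂)) (inj₁ y) tt (closed (inj₁ x) (inj₂ (someVertex X₂)) tt Ax)
series-saturated X₁ X₂ A closed (inj₂ x) Ax (inj₂ y) =
  closed (inj₁ (someVertex X₁)) (inj₂ y) tt (closed (inj₂ x) (inj₁ (someVertex X₁)) tt Ax)

series-closed-size : ∀ X₁ X₂ (A : Vertex (X₁ ⊗ X₂) → Bool) → Closed (X₁ ⊗ X₂) A →
                     sumSel (X₁ ⊗ X₂) A ≡ 0 ⊎ sumSel (X₁ ⊗ X₂) A ≡ totalSize (X₁ ⊗ X₂)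
series-closed-size X₁ X₂ A closed with sumSel (X₁ ⊗ X₂) A ≟ 0
... | yes empty = inj₁ empty
... | no nonempty with x , Ax ← selected-of-positive (X₁ ⊗ X₂) A (n≢0⇒n>0 nonempty) =
  inj₂ (sumSel-all (X₁ ⊗ X₂) A (series-saturated X₁ X₂ A closed x Ax))

module _ (c s : ℕ) (s≤c : s ≤ c) where

  item-table : ∀ a → F c (item a) s ⇔ (s ≡ 0 ⊎ s ≡ a)
  item-table a = mk⇔ to from
    where
    to : F c (item a) s → s ≡ 0 ⊎ s ≡ a
    to (A , size , _) with A tt
    ... | true  = inj₂ (sym size)
    ... | false = inj₁ (sym size)
    from : s ≡ 0 ⊎ s ≡ a → F c (item a) s
    from (inj₁ refl) = witness (item a) (λ _ → false) refl s≤c (none-closed (item a))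
    from (inj₂ refl) = witness (item a) (λ _ → true) refl s≤c (all-closed (item a))

  -- (2) In a disjoint union the operands are chosen independently.
  union-table : ∀ X₁ X₂ → F c (X₁ ⊕ X₂) s ⇔ (Σ ℕ λ s′ → Σ ℕ λ s″ →
                s′ ≤ s × s″ ≤ s × s′ + s″ ≡ s × F c X₁ s′ × F c X₂ s″)
  union-table X₁ X₂ = mk⇔ to from
    where
    to : F c (X₁ ⊕ X₂) s → Σ ℕ λ s′ → Σ ℕ λ s″ →
         s′ ≤ s × s″ ≤ s × s′ + s″ ≡ s × F c X₁ s′ × F c X₂ s″
    to (A , size , _ , closed) =
      s′ , s″ , s′≤s , s″≤s , size
      , witness X₁ _ refl (≤-trans s′≤s s≤c) (λ x y → closed (inj₁ x) (inj₁ y))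
      , witness X₂ _ refl (≤-trans s″≤s s≤c) (λ x y → closed (inj₂ x) (inj₂ y))
      where
      s′ = sumSel X₁ (λ x → A (inj₁ x))
      s″ = sumSel X₂ (λ y → A (inj₂ y))
      s′≤s = subst (s′ ≤_) size (m≤m+n s′ s″)
      s″≤s = subst (s″ ≤_) size (m≤n+m s″ s′)
    from : (Σ ℕ λ s′ → Σ ℕ λ s″ →
            s′ ≤ s × s″ ≤ s × s′ + s″ ≡ s × F c X₁ s′ × F c X₂ s″) → F c (X₁ ⊕ X₂) s
    from (_ , _ , _ , _ , split , (A₁ , size₁ , _ , closed₁) , (A₂ , size₂ , _ , closed₂)) =
      witness (X₁ ⊕ X₂) [ A₁ , A₂ ] (trans (cong₂ _+_ size₁ size₂) split) s≤c closed
      where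
      closed : Closed (X₁ ⊕ X₂) [ A₁ , A₂ ]
      closed (inj₁ x) (inj₁ y) = closed₁ x y
      closed (inj₂ x) (inj₂ y) = closed₂ x y
      closed (inj₁ _) (inj₂ _) ()
      closed (inj₂ _) (inj₁ _) ()

  -- (3) In an order composition either nothing of X₁ counts and X₂ is
  -- chosen freely, or some weight of X₁ is taken together with all of X₂.
  order-table : ∀ X₁ X₂ → F c (X₁ ⊘ X₂) s ⇔ ((s ≤ totalSize X₂ × F c X₂ s)
                ⊎ (Σ ℕ λ s′ → 0 < s′ × s ≡ s′ + totalSize X₂ × F c X₁ s′))
  order-table X₁ X₂ = mk⇔ to from
    where
    to : F c (X₁ ⊘ X₂) s → (s ≤ totalSize X₂ × F c X₂ s)
         ⊎ (Σ ℕ λ s′ → 0 < s′ × s ≡ s′ + totalSize X₂ × F c X₁ s′)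
    to (A , size , _ , closed) with sumSel X₁ (λ x → A (inj₁ x)) in size₁
    ... | zero =
      inj₁ ( subst (_≤ totalSize X₂) size (sumSel≤totalSize X₂ _)
           , witness X₂ _ size s≤c (λ x y → closed (inj₂ x) (inj₂ y)))
    ... | suc k with x , Ax ← selected-of-positive X₁ (λ x → A (inj₁ x))
                                 (subst (0 <_) (sym size₁) (s≤s z≤n)) =
      inj₂ ( suc k , s≤s z≤n , trans (sym size) (cong (suc k +_) all₂)
           , witness X₁ _ size₁ (≤-trans (subst (suc k ≤_) size (m≤m+n (suc k) _)) s≤c)
                     (λ x y → closed (inj₁ x) (inj₁ y)))
      where
      all₂ : sumSel X₂ (λ y → A (inj₂ y)) ≡ totalSize X₂
      all₂ = sumSel-all X₂ _ (λ y → closed (inj₁ x) (inj₂ y) tt Ax)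
    from : (s ≤ totalSize X₂ × F c X₂ s)
           ⊎ (Σ ℕ λ s′ → 0 < s′ × s ≡ s′ + totalSize X₂ × F c X₁ s′) → F c (X₁ ⊘ X₂) s
    from (inj₁ (_ , A₂ , size₂ , _ , closed₂)) =
      witness (X₁ ⊘ X₂) [ (λ _ → false) , A₂ ]
              (cong₂ _+_ (sumSel-none X₁) size₂) s≤c closed
      where
      closed : Closed (X₁ ⊘ X₂) [ (λ _ → false) , A₂ ]
      closed (inj₂ x) (inj₂ y) = closed₂ x y
      closed (inj₁ _) _ _ ()
      closed (inj₂ _) (inj₁ _) ()
    from (inj₂ (_ , _ , split , A₁ , size₁ , _ , closed₁)) =
      witness (X₁ ⊘ X₂) [ A₁ , (λ _ → true) ]
              (trans (cong (_+ totalSize X₂) size₁) (sym split)) s≤c closed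
      where
      closed : Closed (X₁ ⊘ X₂) [ A₁ , (λ _ → true) ]
      closed (inj₁ x) (inj₁ y) = closed₁ x y
      closed _ (inj₂ _) _ _ = refl
      closed (inj₂ _) (inj₁ _) ()

  -- (4) In a series composition only the empty and the full set are closed.
  series-table : ∀ X₁ X₂ → F c (X₁ ⊗ X₂) s ⇔ (s ≡ 0 ⊎ s ≡ totalSize X₁ + totalSize X₂)
  series-table X₁ X₂ = mk⇔ to from
    where
    to : F c (X₁ ⊗ X₂) s → s ≡ 0 ⊎ s ≡ totalSize X₁ + totalSize X₂
    to (A , size , _ , closed) with series-closed-size X₁ X₂ A closed
    ... | inj₁ empty = inj₁ (trans (sym size) empty)
    ... | inj₂ full  = inj₂ (trans (sym size) full)
    from : s ≡ 0 ⊎ s ≡ totalSize X₁ + totalSize X₂ → F c (X₁ ⊗ X₂) s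
    from (inj₁ refl) = witness (X₁ ⊗ X₂) _ (sumSel-none (X₁ ⊗ X₂)) s≤c (none-closed (X₁ ⊗ X₂))
    from (inj₂ refl) = witness (X₁ ⊗ X₂) _ refl s≤c (all-closed (X₁ ⊗ X₂))

lemma10 : (c : ℕ) → 0 < c → (s : ℕ) → s ≤ c →
    ((a : ℕ) → 0 < a → F c (item a) s ⇔ (s ≡ 0 ⊎ s ≡ a))
    × ((X₁ X₂ : DiCo) → AllPos X₁ → AllPos X₂ →
    F c (X₁ ⊕ X₂) s ⇔ (Σ ℕ λ s′ → Σ ℕ λ s″ →
    s′ ≤ s × s″ ≤ s × s′ + s″ ≡ s × F c X₁ s′ × F c X₂ s″))
    × ((X₁ X₂ : DiCo) → AllPos X₁ → AllPos X₂ →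
    F c (X₁ ⊘ X₂) s ⇔ ((s ≤ totalSize X₂ × F c X₂ s)
    ⊎ (Σ ℕ λ s′ → 0 < s′ × s ≡ s′ + totalSize X₂ × F c X₁ s′)))
    × ((X₁ X₂ : DiCo) → AllPos X₁ → AllPos X₂ →
    F c (X₁ ⊗ X₂) s ⇔ (s ≡ 0 ⊎ s ≡ totalSize X₁ + totalSize X₂))
lemma10 c _ s s≤c =
    (λ a _ → item-table c s s≤c a)
  , (λ X₁ X₂ _ _ → union-table c s s≤c X₁ X₂)
  , (λ X₁ X₂ _ _ → order-table c s s≤c X₁ X₂)
  , (λ X₁ X₂ _ _ → series-table c s s≤c X₁ X₂)
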